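{- Let $k\geq 1$, $n\geq 0$ and $s\geq 4k$ be integers, and consider search on paths where the target moves at most $k$ steps after each test. Then $$N_p(n,s)\leq (s-4k)2^n+k(2n+4).$$
   Context: Search model: $G$ is a finite graph on vertex set $\{1,\dots,N\}$ with a loop at every vertex. For $\mathcal A\subseteq\{1,\dots,N\}$, $\Gamma_k(\mathcal A)$ is the set of vertices $j$ such that for some $i\in\mathcal A$ there is a path (walk) from $i$ to $j$ in $G$ of length at most $k$. An unknown target occupies a vertex; a searcher performs tests $\mathcal T_1,\dots,\mathcal T_n\subseteq\{1,\dots,N\}$ one after another; test $i$ returns $y_i=1$ if the target currently lies in $\mathcal T_i$ and $y_i=0$ otherwise; after each test the target moves along a walk of length at most $k$. In an (adaptive) strategy, $\mathcal T_i$ may depend on $y_1,\dots,y_{i-1}$. The sets of possible positions are $\mathcal D_0=\{1,\dots,N\}$ and $\mathcal D_i=\Gamma_k(\mathcal T_i\cap\mathcal D_{i-1})$ if $y_i=1$, $\mathcal D_i=\Gamma_k(\mathcal D_{i-1}\setminus\mathcal T_i)$ if $y_i=0$. A strategy with $n$ tests is $(G,s)$-successful if for every sequence of test results, $|\mathcal D_i|\leq s$ for some $i\in\{0,\dots,n\}$. The path $P_N$ has vertex set $\{1,\dots,N\}$, edges $\{i-1,i\}$ for $2\leq i\leq N$, and a loop at every vertex. $N_p(n,s)$ denotes the maximum $N$ such that a $(P_N,s)$-successful strategy with $n$ tests exists. -}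

module Defs where

open import Data.Bool using (Bool; true; false; _∧_)
open import Data.Nat using (ℕ; zero; suc; _≤_; _≤ᵇ_; ∣_-_∣)
open import Data.Fin using (Fin; toℕ)
open import Data.Fin.Subset using (Subset; _∩_; _─_; ∣_∣)
open import Data.List using (allFin)
open import Data.Bool.ListAction using (any)
open import Data.Vec using (Vec; lookup; tabulate)
open import Data.Product using (_×_; Σ)
open import Data.Sum using (_⊎_)

-- A finite graph on N vertices (vertex i : Fin N stands for vertex toℕ i + 1),
-- given by its (decidable) adjacency relation.
Graph : ℕ → Set
Graph N = Fin N → Fin N → Bool

step : ∀ {N} → Graph N → Subset N → Subset N
step {N} G A = tabulate λ j → any (λ i → lookup A i ∧ G i j) (allFin N)

Reach : ∀ {N} → Graph N → ℕ → Subset N → Subset N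
Reach G zero A = A
Reach G (suc k) A = Data.Vec.zipWith Data.Bool._∨_ (Reach G k A) (step G (Reach G k A))

Γ : ∀ {N} → Graph N → ℕ → Subset N → Subset N
Γ G k A = Reach G k A

Path : (N : ℕ) → Graph N
Path N i j = ∣ toℕ i - toℕ j ∣ ≤ᵇ 1

-- An adaptive strategy with n tests: a decision tree of depth n whose nodes
-- are tests; the next test depends on the previous results.
data Strategy (N : ℕ) : ℕ → Set where
  done : Strategy N zero
  test : ∀ {n} → (T : Subset N)
       → (ifNo : Strategy N n)
       → (ifYes : Strategy N n)
       → Strategy N (suc n)

SuccessfulFrom : ∀ {N n} → Graph N → ℕ → ℕ → Subset N → Strategy N n → Set
SuccessfulFrom G k s D done = ∣ D ∣ ≤ s
SuccessfulFrom G k s D (test T no yes) =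
  ∣ D ∣ ≤ s ⊎
  (SuccessfulFrom G k s (Γ G k (D ─ T)) no × SuccessfulFrom G k s (Γ G k (T ∩ D)) yes)

Successful : ∀ {N n} → Graph N → ℕ → ℕ → Strategy N n → Set
Successful {N} G k s S = SuccessfulFrom G k s Data.Fin.Subset.⊤ S

-- Let W w be the set of vertices at distance at least w from both ends of the path.
-- With m tests left, at most c m = (s − 4k) 2^m + 4k possible positions lie in W (k m).
-- The next answer splits the possible positions D into two parts; if a part X meets
-- W (k (m + 1)), its k-step neighbourhood gains, inside W (k m), the k vertices beyond
-- each of the two extreme points of X ∩ W (k (m + 1)). So by induction each part has at
-- most c m − 2k points in W (k (m + 1)), and D at most 2 c m − 4k = c (m + 1). At the
-- start D is the whole path, which has at least N − 2kn vertices in W (k n).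
module Submission where

open import Defs
open import Data.Bool using (Bool; true; false; T; _∧_; _∨_; not; if_then_else_)
open import Data.Bool.Properties using (T-∧; T-∨; ∧-zeroʳ; ∧-identityʳ)
open import Data.Empty using (⊥-elim)
open import Data.Fin using (toℕ; fromℕ<) renaming (zero to fzero; suc to fsuc)
open import Data.Fin.Properties using (toℕ-fromℕ<)
open import Data.Fin.Subset using (Subset; _∩_; _─_; ∣_∣; ⊤)
open import Data.List.Membership.Propositional using (lose)
open import Data.List.Membership.Propositional.Properties using (∈-allFin)
open import Data.List.Relation.Unary.Any.Properties using (any⁺)
open import Data.Nat
  using (ℕ; zero; suc; ∣_-_∣; _≤ᵇ_; _<ᵇ_; _≤_; _<_; _+_; _*_; _∸_; _^_; z≤n; s≤s; z<s; s<s)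
open import Data.Nat.Properties
open import Data.Nat.Tactic.RingSolver using (solve-∀)
open import Data.Product using (∃; _×_; _,_; proj₁; proj₂)
open import Data.Sum using (_⊎_; inj₁; inj₂)
open import Data.Vec using ([]; _∷_; zipWith; lookup)
open import Data.Vec.Properties using (lookup∘tabulate)
open import Function using (_∘_; Equivalence)
open import Relation.Binary.PropositionalEquality
open import Relation.Nullary using (¬_)

open Equivalence using (to; from)

m<n∸o⇒m+o<n : ∀ {m n o} → m < n ∸ o → m + o < n
m<n∸o⇒m+o<n {m} {n}     {zero}  m<n   = subst (_< n) (sym (+-identityʳ m)) m<n
m<n∸o⇒m+o<n {m} {suc n} {suc o} m<n∸o = subst (_< suc n) (sym (+-suc m o)) (s<s (m<n∸o⇒m+o<n m<n∸o))

count : (ℕ → Bool) → ℕ → ℕ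
count p zero    = 0
count p (suc n) = if p 0 then suc (count (p ∘ suc) n) else count (p ∘ suc) n

count-mono : ∀ {p q} n → (∀ {i} → i < n → T (p i) → T (q i)) → count p n ≤ count q n
count-mono zero _ = z≤n
count-mono {p} {q} (suc n) p⇒q with p 0 | q 0 | p⇒q {0} z<s
... | true  | true  | _ = s≤s (count-mono n (p⇒q ∘ s<s))
... | true  | false | p0⇒q0 = ⊥-elim (p0⇒q0 _)
... | false | true  | _ = m≤n⇒m≤1+n (count-mono n (p⇒q ∘ s<s))
... | false | false | _ = count-mono n (p⇒q ∘ s<s)

count-monoʳ : ∀ {p m n} → m ≤ n → count p m ≤ count p n
count-monoʳ z≤n = z≤n
count-monoʳ {p} (s≤s m≤n) with p 0
... | true  = s≤s (count-monoʳ m≤n)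
... | false = count-monoʳ m≤n

count-cong : ∀ {p q} n → (∀ i → p i ≡ q i) → count p n ≡ count q n
count-cong zero _ = refl
count-cong {p} {q} (suc n) p≗q with p 0 | q 0 | p≗q 0
... | true  | .true  | refl = cong suc (count-cong n (p≗q ∘ suc))
... | false | .false | refl = count-cong n (p≗q ∘ suc)

count-∨ : ∀ {p q} n → (∀ {i} → T (p i) → ¬ T (q i)) →
          count (λ i → p i ∨ q i) n ≡ count p n + count q n
count-∨ zero _ = refl
count-∨ {p} {q} (suc n) disjoint with p 0 | q 0 | disjoint {0}
... | true  | true  | p0#q0 = ⊥-elim (p0#q0 _ _)
... | true  | false | _ = cong suc (count-∨ n disjoint)
... | false | true  | _ = trans (cong suc (count-∨ n disjoint)) (sym (+-suc _ _))
... | false | false | _ = count-∨ n disjoint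

count-split : ∀ {p q : ℕ → Bool} (c : ℕ → Bool) n → count (λ i → p i ∧ q i) n ≡
  count (λ i → (c i ∧ p i) ∧ q i) n + count (λ i → (p i ∧ not (c i)) ∧ q i) n
count-split c zero = refl
count-split {p} {q} c (suc n) with c 0 | p 0 | q 0
... | true  | true  | true  = cong suc (count-split {p ∘ suc} {q ∘ suc} (c ∘ suc) n)
... | false | true  | true  = trans (cong suc (count-split {p ∘ suc} {q ∘ suc} (c ∘ suc) n)) (sym (+-suc _ _))
... | true  | true  | false = count-split {p ∘ suc} {q ∘ suc} (c ∘ suc) n
... | false | true  | false = count-split {p ∘ suc} {q ∘ suc} (c ∘ suc) n
... | true  | false | _     = count-split {p ∘ suc} {q ∘ suc} (c ∘ suc) n
... | false | false | _     = count-split {p ∘ suc} {q ∘ suc} (c ∘ suc) n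

∸-≤-count : ∀ {p} a b → (∀ {i} → a ≤ i → i < b → T (p i)) → b ∸ a ≤ count p b
∸-≤-count zero    zero    _ = z≤n
∸-≤-count (suc a) zero    _ = z≤n
∸-≤-count {p} zero (suc b) inside with p 0 | inside {0} z≤n z<s
... | true | _ = s≤s (∸-≤-count 0 b (λ _ → inside z≤n ∘ s<s))
∸-≤-count {p} (suc a) (suc b) inside with p 0
... | true  = m≤n⇒m≤1+n (∸-≤-count a b (λ a≤i → inside (s≤s a≤i) ∘ s<s))
... | false = ∸-≤-count a b (λ a≤i → inside (s≤s a≤i) ∘ s<s)

count≡0⇒¬ : ∀ {p} n → count p n ≡ 0 → ∀ {i} → i < n → ¬ T (p i)
count≡0⇒¬ {p} (suc n) none {zero} _ with p 0
count≡0⇒¬ (suc n) () _ | true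
... | false = λ ()
count≡0⇒¬ {p} (suc n) none {suc i} (s<s i<n) with p 0
count≡0⇒¬ (suc n) () _ | true
... | false = count≡0⇒¬ n none i<n

count-least : ∀ {p} n → 0 < count p n →
              ∃ λ x → T (p x) × (∀ {i} → i < x → ¬ T (p i))
count-least {p} (suc n) pos with p 0 in p0
... | true  = 0 , subst T (sym p0) _ , λ ()
... | false = let x , px , below = count-least n pos in
              suc x , px , λ { {zero} _ → subst T p0 ; {suc i} (s<s i<x) → below i<x }

count-greatest : ∀ {p} n → 0 < count p n →
                 ∃ λ x → T (p x) × (∀ {i} → x < i → i < n → ¬ T (p i))
count-greatest {p} (suc n) pos with count (p ∘ suc) n in c≡ | p 0 in p0
... | suc _ | _ =
  let x , px , above = count-greatest n (subst (0 <_) (sym c≡) z<s) in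
  suc x , px , λ { (s<s x<i) (s<s i<n) → above x<i i<n }
... | zero | true  = 0 , subst T (sym p0) _ , λ { {suc i} _ (s<s i<n) → count≡0⇒¬ n c≡ i<n }
... | zero | false = ⊥-elim (n≮0 pos)

between : ℕ → ℕ → ℕ → Bool
between a b i = (a ≤ᵇ i) ∧ (i <ᵇ b)

between-intro : ∀ {a b i} → a ≤ i → i < b → T (between a b i)
between-intro a≤i i<b = from T-∧ (≤⇒≤ᵇ a≤i , <⇒<ᵇ i<b)

between-elim : ∀ a b {i} → T (between a b i) → a ≤ i × i < b
between-elim a b {i} h = let a≤ᵇi , i<ᵇb = to T-∧ h in ≤ᵇ⇒≤ a i a≤ᵇi , <ᵇ⇒< i b i<ᵇb

count-spread : ∀ {p q : ℕ → Bool} n k → 0 < count p n →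
               (∀ {i} → T (p i) → k ≤ i × i + k < n) →
               (∀ {i j} → T (p i) → i ≤ j + k → j ≤ i + k → T (q j)) →
               count p n + 2 * k ≤ count q n
count-spread {p} {q} n k nonempty inner nbhd
  with count-least n nonempty | count-greatest n nonempty
... | x , px , below | y , py , above = begin
  count p n + 2 * k                                 ≡⟨ cong (count p n +_) (cong (k +_) (+-identityʳ k)) ⟩
  count p n + (k + k)                               ≡⟨ +-assoc (count p n) k k ⟨
  count p n + k + k                                 ≤⟨ +-mono-≤ (+-monoʳ-≤ (count p n) k≤left) k≤right ⟩
  count p n + count left n + count right n          ≡⟨ cong (_+ count right n) (count-∨ n left-disjoint) ⟨
  count (λ i → p i ∨ left i) n + count right n      ≡⟨ count-∨ n right-disjoint ⟨
  count (λ i → (p i ∨ left i) ∨ right i) n          ≤⟨ count-mono n covered ⟩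
  count q n                                         ∎
  where
  open ≤-Reasoning
  left right : ℕ → Bool
  left  = between (x ∸ k) x
  right = between (suc y) (suc (y + k))

  k≤x : k ≤ x
  k≤x = proj₁ (inner px)
  x≤y : x ≤ y
  x≤y = ≮⇒≥ (λ y<x → below y<x py)
  y+k<n : y + k < n
  y+k<n = proj₂ (inner py)

  k≤left : k ≤ count left n
  k≤left = begin
    k                   ≡⟨ m∸[m∸n]≡n k≤x ⟨
    x ∸ (x ∸ k)         ≤⟨ ∸-≤-count (x ∸ k) x between-intro ⟩
    count left x        ≤⟨ count-monoʳ (≤-trans x≤y (≤-trans (m≤m+n y k) (<⇒≤ y+k<n))) ⟩
    count left n        ∎
  k≤right : k ≤ count right n
  k≤right = begin
    k                              ≡⟨ m+n∸m≡n y k ⟨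
    suc (y + k) ∸ suc y            ≤⟨ ∸-≤-count (suc y) (suc (y + k)) between-intro ⟩
    count right (suc (y + k))      ≤⟨ count-monoʳ y+k<n ⟩
    count right n                  ∎

  left-disjoint : ∀ {i} → T (p i) → ¬ T (left i)
  left-disjoint pi li = below (proj₂ (between-elim (x ∸ k) x li)) pi
  right-disjoint : ∀ {i} → T (p i ∨ left i) → ¬ T (right i)
  right-disjoint {i} h ri with to T-∨ h | proj₁ (between-elim (suc y) (suc (y + k)) ri)
  ... | inj₁ pi | y<i = above y<i (≤-<-trans (m≤m+n i k) (proj₂ (inner pi))) pi
  ... | inj₂ li | y<i = <-irrefl refl (<-trans (<-≤-trans (proj₂ (between-elim (x ∸ k) x li)) x≤y) y<i)

  covered : ∀ {i} → i < n → T ((p i ∨ left i) ∨ right i) → T (q i)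
  covered {i} _ h with to T-∨ h
  ... | inj₂ ri = let y<i , i<1+y+k = between-elim (suc y) (suc (y + k)) ri in
                  nbhd py (≤-trans (<⇒≤ y<i) (m≤m+n i k)) (≤-pred i<1+y+k)
  ... | inj₁ h′ with to T-∨ h′
  ...   | inj₁ pi = nbhd pi (m≤m+n i k) (m≤m+n i k)
  ...   | inj₂ li = let x∸k≤i , i<x = between-elim (x ∸ k) x li in
                    nbhd px (x≤i+k x∸k≤i) (≤-trans (<⇒≤ i<x) (m≤m+n x k))
    where
    x≤i+k : x ∸ k ≤ i → x ≤ i + k
    x≤i+k x∸k≤i = begin
      x            ≤⟨ m≤n+m∸n x k ⟩
      k + (x ∸ k)  ≤⟨ +-monoʳ-≤ k x∸k≤i ⟩
      k + i        ≡⟨ +-comm k i ⟩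
      i + k        ∎

-- Membership of a natural number in a subset of Fin N; numbers ≥ N are never members.
at : ∀ {N} → Subset N → ℕ → Bool
at []      _       = false
at (b ∷ v) zero    = b
at (b ∷ v) (suc i) = at v i

∣∣≡count-at : ∀ {N} (v : Subset N) → ∣ v ∣ ≡ count (at v) N
∣∣≡count-at []          = refl
∣∣≡count-at (true ∷ v)  = cong suc (∣∣≡count-at v)
∣∣≡count-at (false ∷ v) = ∣∣≡count-at v

at-toℕ : ∀ {N} (v : Subset N) i → at v (toℕ i) ≡ lookup v i
at-toℕ (b ∷ v) fzero    = refl
at-toℕ (b ∷ v) (fsuc i) = at-toℕ v i

at≡lookup : ∀ {N} (v : Subset N) {i} (i<N : i < N) → at v i ≡ lookup v (fromℕ< i<N)
at≡lookup v i<N = trans (cong (at v) (sym (toℕ-fromℕ< i<N))) (at-toℕ v _)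

at⇒< : ∀ {N} (v : Subset N) {i} → T (at v i) → i < N
at⇒< (b ∷ v) {zero}  _  = z<s
at⇒< (b ∷ v) {suc i} vi = s<s (at⇒< v vi)

at-⊤ : ∀ {N i} → i < N → T (at (⊤ {N}) i)
at-⊤ {suc N} {zero}  _         = _
at-⊤ {suc N} {suc i} (s<s i<N) = at-⊤ i<N

at-zipWith : ∀ {N} {f : Bool → Bool → Bool} → f false false ≡ false →
             (u v : Subset N) (i : ℕ) → at (zipWith f u v) i ≡ f (at u i) (at v i)
at-zipWith f00 []      []      i       = sym f00
at-zipWith f00 (a ∷ u) (b ∷ v) zero    = refl
at-zipWith f00 (a ∷ u) (b ∷ v) (suc i) = at-zipWith f00 u v i

at-∩ : ∀ {N} (u v : Subset N) (i : ℕ) → at (u ∩ v) i ≡ at u i ∧ at v i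
at-∩ = at-zipWith refl

at-─ : ∀ {N} (u v : Subset N) (i : ℕ) → at (u ─ v) i ≡ at u i ∧ not (at v i)
at-─ []          []          i       = refl
at-─ (a ∷ u)     (true ∷ v)  zero    = sym (∧-zeroʳ a)
at-─ (a ∷ u)     (false ∷ v) zero    = sym (∧-identityʳ a)
at-─ (a ∷ u)     (b ∷ v)     (suc i) = at-─ u v i

∈-step : ∀ {N} (G : Graph N) (R : Subset N) {i j} →
         T (lookup R i) → T (G i j) → T (lookup (step G R) j)
∈-step {N} G R {i} {j} Ri Gij =
  subst T (sym (lookup∘tabulate _ j)) (any⁺ _ (lose (∈-allFin i) (from T-∧ (Ri , Gij))))

∈-step-Path : ∀ {N} (R : Subset N) {i j} → T (at R i) → j < N → ∣ i - j ∣ ≤ 1 →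
              T (at (step (Path N) R) j)
∈-step-Path {N} R {i} {j} Ri j<N ∣i-j∣≤1 =
  subst T (sym (at≡lookup (step (Path N) R) j<N))
    (∈-step (Path N) R (subst T (at≡lookup R i<N) Ri) adjacent)
  where
  i<N : i < N
  i<N = at⇒< R Ri
  adjacent : T (Path N (fromℕ< i<N) (fromℕ< j<N))
  adjacent = subst₂ (λ a b → T (∣ a - b ∣ ≤ᵇ 1))
               (sym (toℕ-fromℕ< i<N)) (sym (toℕ-fromℕ< j<N)) (≤⇒≤ᵇ ∣i-j∣≤1)

∣n-1+n∣≤1 : ∀ n → ∣ n - suc n ∣ ≤ 1
∣n-1+n∣≤1 zero    = ≤-refl
∣n-1+n∣≤1 (suc n) = ∣n-1+n∣≤1 n

∣1+n-n∣≤1 : ∀ n → ∣ suc n - n ∣ ≤ 1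
∣1+n-n∣≤1 zero    = ≤-refl
∣1+n-n∣≤1 (suc n) = ∣1+n-n∣≤1 n

∈-Reach-suc : ∀ {N} (G : Graph N) k A {j} →
              T (at (Reach G k A) j) ⊎ T (at (step G (Reach G k A)) j) →
              T (at (Reach G (suc k) A) j)
∈-Reach-suc G k A {j} h =
  subst T (sym (at-zipWith refl (Reach G k A) (step G (Reach G k A)) j)) (from T-∨ h)

∈-Reach-up : ∀ {N} (A : Subset N) {x} d k → T (at A x) → d ≤ k → d + x < N →
             T (at (Reach (Path N) k A) (d + x))
∈-Reach-up A zero    zero    Ax _ _ = Ax
∈-Reach-up A zero    (suc k) Ax _ x<N = ∈-Reach-suc (Path _) k A (inj₁ (∈-Reach-up A zero k Ax z≤n x<N))
∈-Reach-up {N} A {x} (suc d) (suc k) Ax (s≤s d≤k) 1+d+x<N =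
  ∈-Reach-suc (Path N) k A (inj₂ (∈-step-Path (Reach (Path N) k A)
    (∈-Reach-up A d k Ax d≤k (<-trans (n<1+n _) 1+d+x<N)) 1+d+x<N (∣n-1+n∣≤1 (d + x))))

∈-Reach-down : ∀ {N} (A : Subset N) {y} d k → T (at A (d + y)) → d ≤ k →
               T (at (Reach (Path N) k A) y)
∈-Reach-down A zero    zero    Ay _ = Ay
∈-Reach-down A zero    (suc k) Ay _ = ∈-Reach-suc (Path _) k A (inj₁ (∈-Reach-down A zero k Ay z≤n))
∈-Reach-down {N} A {y} (suc d) (suc k) A1+d+y (s≤s d≤k) =
  ∈-Reach-suc (Path N) k A (inj₂ (∈-step-Path R R1+y (<-trans (n<1+n y) (at⇒< R R1+y)) (∣1+n-n∣≤1 y)))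
  where
  R : Subset N
  R = Reach (Path N) k A
  R1+y : T (at R (suc y))
  R1+y = ∈-Reach-down A d k (subst (T ∘ at A) (sym (+-suc d y)) A1+d+y) d≤k

∈-Reach-Path : ∀ {N} (A : Subset N) {x j} k → T (at A x) → x ≤ j + k → j ≤ x + k → j < N →
               T (at (Reach (Path N) k A) j)
∈-Reach-Path {N} A {x} {j} k Ax x≤j+k j≤x+k j<N with ≤-total x j
... | inj₁ x≤j = subst (T ∘ at (Reach (Path N) k A)) (m∸n+n≡m x≤j)
                   (∈-Reach-up A (j ∸ x) k Ax (m≤n+o⇒m∸n≤o j x j≤x+k)
                     (subst (_< N) (sym (m∸n+n≡m x≤j)) j<N))
... | inj₂ j≤x = ∈-Reach-down A (x ∸ j) k (subst (T ∘ at A) (sym (m∸n+n≡m j≤x)) Ax)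
                   (m≤n+o⇒m∸n≤o x j x≤j+k)

window : ℕ → ℕ → ℕ → Bool
window N w i = (w ≤ᵇ i) ∧ (i + w <ᵇ N)

window-intro : ∀ {N w i} → w ≤ i → i + w < N → T (window N w i)
window-intro w≤i i+w<N = from T-∧ (≤⇒≤ᵇ w≤i , <⇒<ᵇ i+w<N)

window-elim : ∀ N w {i} → T (window N w i) → w ≤ i × i + w < N
window-elim N w {i} h =
  let w≤ᵇi , i+w<ᵇN = to T-∧ h in ≤ᵇ⇒≤ w i w≤ᵇi , <ᵇ⇒< (i + w) N i+w<ᵇN

window-spread : ∀ N k w {i j} → T (window N (k + w) i) → i ≤ j + k → j ≤ i + k →
                T (window N w j)
window-spread N k w {i} {j} h i≤j+k j≤i+k = window-intro w≤j j+w<N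
  where
  k+w≤i : k + w ≤ i
  k+w≤i = proj₁ (window-elim N (k + w) h)
  i+[k+w]<N : i + (k + w) < N
  i+[k+w]<N = proj₂ (window-elim N (k + w) h)
  w≤j : w ≤ j
  w≤j = +-cancelˡ-≤ k w j (≤-trans k+w≤i (≤-trans i≤j+k (≤-reflexive (+-comm j k))))
  j+w<N : j + w < N
  j+w<N = ≤-<-trans (+-monoˡ-≤ w j≤i+k) (subst (_< N) (sym (+-assoc i k w)) i+[k+w]<N)

windowCount : ∀ {N} → ℕ → Subset N → ℕ
windowCount {N} w X = count (λ i → at X i ∧ window N w i) N

windowCount≤∣∣ : ∀ {N} w (X : Subset N) → windowCount w X ≤ ∣ X ∣
windowCount≤∣∣ {N} w X =
  ≤-trans (count-mono N (λ _ → proj₁ ∘ to T-∧)) (≤-reflexive (sym (∣∣≡count-at X)))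

windowCount-split : ∀ {N} w (D T : Subset N) →
                    windowCount w D ≡ windowCount w (T ∩ D) + windowCount w (D ─ T)
windowCount-split {N} w D T = trans (count-split (at T) N) (cong₂ _+_
  (count-cong N (λ i → cong (_∧ window N w i) (sym (at-∩ T D i))))
  (count-cong N (λ i → cong (_∧ window N w i) (sym (at-─ D T i)))))

windowCount-⊤ : ∀ N w → N ∸ (w + w) ≤ windowCount w (⊤ {N})
windowCount-⊤ N w = begin
  N ∸ (w + w)          ≡⟨ ∸-+-assoc N w w ⟨
  N ∸ w ∸ w            ≤⟨ ∸-≤-count w (N ∸ w) inside ⟩
  count p (N ∸ w)      ≤⟨ count-monoʳ (m∸n≤m N w) ⟩
  count p N            ∎
  where
  open ≤-Reasoning
  p : ℕ → Bool
  p i = at (⊤ {N}) i ∧ window N w i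
  inside : ∀ {i} → w ≤ i → i < N ∸ w → T (p i)
  inside {i} w≤i i<N∸w = from T-∧ (at-⊤ (≤-<-trans (m≤m+n i w) i+w<N) , window-intro w≤i i+w<N)
    where
    i+w<N : i + w < N
    i+w<N = m<n∸o⇒m+o<n i<N∸w

windowCount-growth : ∀ {N} k w (X : Subset N) → 0 < windowCount (k + w) X →
                     windowCount (k + w) X + 2 * k ≤ windowCount w (Γ (Path N) k X)
windowCount-growth {N} k w X nonempty = count-spread N k nonempty inner nbhd
  where
  inner : ∀ {i} → T (at X i ∧ window N (k + w) i) → k ≤ i × i + k < N
  inner {i} h = let k+w≤i , i+[k+w]<N = window-elim N (k + w) (proj₂ (to (T-∧ {at X i}) h)) in
                ≤-trans (m≤m+n k w) k+w≤i , ≤-<-trans (+-monoʳ-≤ i (m≤m+n k w)) i+[k+w]<N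
  nbhd : ∀ {i j} → T (at X i ∧ window N (k + w) i) → i ≤ j + k → j ≤ i + k →
         T (at (Γ (Path N) k X) j ∧ window N w j)
  nbhd {i} {j} h i≤j+k j≤i+k = from T-∧ (∈-Reach-Path X k Xi i≤j+k j≤i+k j<N , wj)
    where
    Xi : T (at X i)
    Xi = proj₁ (to (T-∧ {at X i}) h)
    wj : T (window N w j)
    wj = window-spread N k w (proj₂ (to (T-∧ {at X i}) h)) i≤j+k j≤i+k
    j<N : j < N
    j<N = ≤-<-trans (m≤m+n j w) (proj₂ (window-elim N w wj))

capacity : ℕ → ℕ → ℕ → ℕ
capacity s k n = (s ∸ 4 * k) * 2 ^ n + 4 * k

s≤capacity : ∀ s k n → 4 * k ≤ s → s ≤ capacity s k n
s≤capacity s k n 4k≤s = begin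
  s                             ≡⟨ m∸n+n≡m 4k≤s ⟨
  s ∸ 4 * k + 4 * k             ≤⟨ +-monoˡ-≤ (4 * k) (m≤m*n (s ∸ 4 * k) (2 ^ n) {{m^n≢0 2 n}}) ⟩
  capacity s k n                ∎
  where open ≤-Reasoning

2k≤capacity : ∀ s k n → 2 * k ≤ capacity s k n
2k≤capacity s k n =
  ≤-trans (*-monoˡ-≤ k {2} {4} (s≤s (s≤s z≤n))) (m≤n+m (4 * k) ((s ∸ 4 * k) * 2 ^ n))

capacity-suc : ∀ s k n a b → a + 2 * k ≤ capacity s k n → b + 2 * k ≤ capacity s k n →
               a + b ≤ capacity s k (suc n)
capacity-suc s k n a b a≤ b≤ = +-cancelʳ-≤ (4 * k) (a + b) _ (begin
  a + b + 4 * k                                ≡⟨ regroup a b k ⟩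
  (a + 2 * k) + (b + 2 * k)                    ≤⟨ +-mono-≤ a≤ b≤ ⟩
  capacity s k n + capacity s k n              ≡⟨ double (s ∸ 4 * k) (2 ^ n) k ⟩
  capacity s k (suc n) + 4 * k                 ∎)
  where
  open ≤-Reasoning
  regroup : ∀ a b k → a + b + 4 * k ≡ (a + 2 * k) + (b + 2 * k)
  regroup = solve-∀
  double : ∀ c p k → (c * p + 4 * k) + (c * p + 4 * k) ≡ c * (2 * p) + 4 * k + 4 * k
  double = solve-∀

windowCount≤capacity : ∀ {N} s k n w (D : Subset N) → 4 * k ≤ s → ∣ D ∣ ≤ s →
                       windowCount w D ≤ capacity s k n
windowCount≤capacity s k n w D 4k≤s ∣D∣≤s =
  ≤-trans (windowCount≤∣∣ w D) (≤-trans ∣D∣≤s (s≤capacity s k n 4k≤s))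

windowCount-shrink : ∀ {N} k w (X : Subset N) {c} → windowCount w (Γ (Path N) k X) ≤ c →
                     2 * k ≤ c → windowCount (k + w) X + 2 * k ≤ c
windowCount-shrink k w X ΓX≤c 2k≤c with windowCount (k + w) X | windowCount-growth k w X
... | zero  | _    = 2k≤c
... | suc _ | grow = ≤-trans (grow z<s) ΓX≤c

windowCount-bound : ∀ {N} k s → 4 * k ≤ s → ∀ {n} (S : Strategy N n) (D : Subset N) →
                    SuccessfulFrom (Path N) k s D S → windowCount (k * n) D ≤ capacity s k n
windowCount-bound k s 4k≤s {n} done D ∣D∣≤s = windowCount≤capacity s k n _ D 4k≤s ∣D∣≤s
windowCount-bound k s 4k≤s {n} (test T S₀ S₁) D (inj₁ ∣D∣≤s) =
  windowCount≤capacity s k n _ D 4k≤s ∣D∣≤s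
windowCount-bound {N} k s 4k≤s {suc m} (test T S₀ S₁) D (inj₂ (success₀ , success₁))
  rewrite *-suc k m =
    ≤-trans (≤-reflexive (windowCount-split w D T))
            (capacity-suc s k m (windowCount w (T ∩ D)) (windowCount w (D ─ T))
                          (shrink S₁ success₁) (shrink S₀ success₀))
  where
  w : ℕ
  w = k + k * m
  shrink : ∀ {X} (S : Strategy N m) → SuccessfulFrom (Path N) k s (Γ (Path N) k X) S →
           windowCount w X + 2 * k ≤ capacity s k m
  shrink {X} S success = windowCount-shrink k (k * m) X
    (windowCount-bound k s 4k≤s S (Γ (Path N) k X) success) (2k≤capacity s k m)

theorem4 : (k n s : ℕ) → 1 ≤ k → 4 * k ≤ s →
    (N : ℕ) → (S : Strategy N n) → Successful (Path N) k s S →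
    N ≤ (s ∸ 4 * k) * 2 ^ n + k * (2 * n + 4)
theorem4 k n s _ 4k≤s N S success = begin
  N                                       ≤⟨ m≤n+m∸n N (2kn) ⟩
  2kn + (N ∸ 2kn)                         ≤⟨ +-monoʳ-≤ 2kn (windowCount-⊤ N (k * n)) ⟩
  2kn + windowCount (k * n) (⊤ {N})       ≤⟨ +-monoʳ-≤ 2kn (windowCount-bound k s 4k≤s S ⊤ success) ⟩
  2kn + capacity s k n                    ≡⟨ rearrange (s ∸ 4 * k) (2 ^ n) k n ⟩
  (s ∸ 4 * k) * 2 ^ n + k * (2 * n + 4)   ∎
  where
  open ≤-Reasoning
  2kn : ℕ
  2kn = k * n + k * n
  rearrange : ∀ c p k n → k * n + k * n + (c * p + 4 * k) ≡ c * p + k * (2 * n + 4)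
  rearrange = solve-∀
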